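{- Let $x,y$ be integers with $x\ge 0$ and $M(x,y)\ne\emptyset$, let $G_0$ be a minimal graph in $M(x,y)$, let $A\ne\emptyset$ be an independent set of vertices of $G_0$, and let $G_0'=G_0-A$. Then (a) $\chi(G_0')=\chi(G_0)-1$; (b) $\omega(G_0')=\omega(G_0)$; (c) $|V(G_0)|=\chi(G_0)+2f(G_0)-x-1$.
   Context: All graphs are finite, simple and undirected (the graph with empty vertex set is allowed). $\chi(G)$ is the chromatic number, $\omega(G)$ the clique number, and $f(G)=\chi(G)-\omega(G)$. For integers $x,y$, $M(x,y)$ is the set of graphs $G$ with $|V(G)|<\chi(G)+2f(G)-x$ and $f(G)\le y$. A minimal graph in a nonempty set $\mathcal M$ of graphs is a $G_0\in\mathcal M$ with $|V(G_0)|=\min\{|V(G)|:G\in\mathcal M\}$. $G_0-A$ is the induced subgraph on $V(G_0)\setminus A$. -}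

module Defs where

open import Data.Bool using (Bool; true; false)
open import Data.Nat using (ℕ; _≤_)
open import Data.Integer as ℤ using (ℤ; +_)
open import Data.Fin using (Fin)
open import Data.Fin.Subset using (Subset; _∈_; _⊆_; ∣_∣; ⊤)
open import Data.Product using (Σ; _×_; ∃)
open import Relation.Binary.PropositionalEquality using (_≡_; _≢_)
open import Relation.Nullary using (¬_)

record Graph (n : ℕ) : Set where
  field
    adj    : Fin n → Fin n → Bool
    sym    : ∀ u v → adj u v ≡ adj v u
    irrefl : ∀ v → adj v v ≡ false

open Graph public

Adj : ∀ {n} → Graph n → Fin n → Fin n → Set
Adj G u v = adj G u v ≡ true

-- Everything below is about the induced subgraph G[S] for S ⊆ V(G);
-- G itself is G[⊤], and G - A is G[V ∖ A].

Colourable : ∀ {n} → Graph n → Subset n → ℕ → Set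
Colourable {n} G S k =
  Σ (Fin n → Fin k) λ c → ∀ u v → u ∈ S → v ∈ S → Adj G u v → c u ≢ c v

IsChromaticNumber : ∀ {n} → Graph n → Subset n → ℕ → Set
IsChromaticNumber G S k = Colourable G S k × (∀ j → Colourable G S j → k ≤ j)

IsClique : ∀ {n} → Graph n → Subset n → Subset n → Set
IsClique G S K = K ⊆ S × (∀ u v → u ∈ K → v ∈ K → u ≢ v → Adj G u v)

IsCliqueNumber : ∀ {n} → Graph n → Subset n → ℕ → Set
IsCliqueNumber G S k =
  (∃ λ K → IsClique G S K × ∣ K ∣ ≡ k) × (∀ K → IsClique G S K → ∣ K ∣ ≤ k)

IsIndependent : ∀ {n} → Graph n → Subset n → Set
IsIndependent G A = ∀ u v → u ∈ A → v ∈ A → ¬ Adj G u v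

fval : ℕ → ℕ → ℤ
fval χ ω = + χ ℤ.- + ω

InM : ℤ → ℤ → ∀ {n} → Graph n → Set
InM x y {n} G = Σ ℕ λ χ → Σ ℕ λ ω →
  IsChromaticNumber G ⊤ χ × IsCliqueNumber G ⊤ ω ×
  (+ n ℤ.< + χ ℤ.+ + 2 ℤ.* fval χ ω ℤ.- x) × (fval χ ω ℤ.≤ y)

IsMinimalInM : ℤ → ℤ → ∀ {n} → Graph n → Set
IsMinimalInM x y {n} G = InM x y G × (∀ m (H : Graph m) → InM x y H → n ≤ m)

-- Write d(H) = |V(H)| − χ(H). Then H ∈ M(x,y) iff d(H) + x < 2 f(H) and f(H) ≤ y. Deleting a nonempty
-- independent set lowers χ by at most one, does not raise ω, and does not raise d. The key claim is that
-- every proper induced subgraph H of G₀ with d(H) ≤ d(G₀) has f(H) < f(G₀). Otherwise delete the top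
-- colour class of an optimal colouring of H again and again: d stays ≤ d(G₀) and f drops by at most one
-- per step, and it must eventually fall below f(G₀) > 0 because f ≤ 0 once χ = 0. At the step where it
-- equals f(G₀) the subgraph lies in M(x,y) and is smaller than G₀, contradicting minimality.
-- For H = G₀ − A the claim leaves only χ(H) = χ(G₀) − 1 and ω(H) = ω(G₀), which is (a) and (b).
-- For (c), G₀ is not complete (a complete graph has f = 0), and deleting two non-adjacent vertices lowers
-- both d and f by one by (a) and (b); the result would lie in M(x,y) if |V(G₀)| had any room to spare.

module Submission where

open import Defs
open import Data.Bool using (Bool; true; false) renaming (_≟_ to _≟ᵇ_)
open import Data.Empty using (⊥; ⊥-elim)
open import Data.Fin using (Fin; zero; suc; toℕ; fromℕ<)
open import Data.Fin.Properties using (toℕ<n; toℕ-injective; toℕ-fromℕ<) renaming (suc-injective to suc-injectiveᶠ)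
open import Data.Fin.Subset using (Subset; ⊤; ∁; Nonempty; _∈_; _∉_; _⊆_; _⊂_; ∣_∣; ⁅_⁆; _∩_; _∪_) renaming (⊥ to ∅)
open import Data.Fin.Subset.Properties
open import Data.Integer as ℤ using (ℤ)
import Data.Integer.Properties as ℤP
import Data.Integer.Tactic.RingSolver as ℤRing
open import Data.Nat using (ℕ; zero; suc; _+_; _*_; _<_; _≤_; _≟_; _<?_; s≤s; z≤n)
open import Data.Nat.Induction using (<-rec)
open import Data.Nat.Properties
import Data.Nat.Tactic.RingSolver as ℕRing
open import Data.Product using (Σ; ∃; ∃₂; _×_; _,_; proj₁; proj₂)
open import Data.Sum using (_⊎_; inj₁; inj₂)
open import Data.Vec using (_∷_; []; here; there; tabulate)
open import Data.Vec.Properties using (lookup∘tabulate; lookup⇒[]=; []=⇒lookup)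
open import Effect.Monad using (RawMonad)
open import Function using (_∘_; id)
open import Function.Bundles using (Equivalence; _⇔_; mk⇔)
open import Level using (0ℓ)
open import Relation.Binary.PropositionalEquality using (_≡_; _≢_; refl; cong; cong₂; trans; subst; subst₂; module ≡-Reasoning)
import Relation.Binary.PropositionalEquality as ≡
open import Relation.Nullary using (¬_; Dec; yes; no; does; contradiction; ¬¬-excluded-middle)
open import Relation.Nullary.Decidable using (dec-true; decidable-stable)
open import Relation.Nullary.Negation using (¬¬-Monad)
open import Relation.Unary using (Pred; Decidable)

private variable
  n k j w : ℕ
  G : Graph n
  S T K : Subset n
  u v : Fin n

satisfying : {P : Pred (Fin n) 0ℓ} → Decidable P → Subset n
satisfying P? = tabulate (does ∘ P?)

module _ {P : Pred (Fin n) 0ℓ} (P? : Decidable P) where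

  ∈satisfying⁺ : P v → v ∈ satisfying P?
  ∈satisfying⁺ {v} p = lookup⇒[]= v _ (trans (lookup∘tabulate (does ∘ P?) v) (dec-true (P? v) p))

  ∈satisfying⁻ : v ∈ satisfying P? → P v
  ∈satisfying⁻ {v} v∈ = decide (P? v) (trans (≡.sym (lookup∘tabulate (does ∘ P?) v)) ([]=⇒lookup v∈))
    where
    decide : (d : Dec (P v)) → does d ≡ true → P v
    decide (yes p) _ = p

Adj-irrefl : (G : Graph n) → ∀ v → ¬ Adj G v v
Adj-irrefl G v a = contradiction (trans (≡.sym a) (irrefl G v)) λ ()

-- Colourings of Defs are total maps into Fin k, so for n > 0 not even the empty vertex set has a 0-colouring.
-- These colourings are constrained only on S, which makes χ(G[∅]) = 0 as for the empty graph.
Colourable′ : Graph n → Subset n → ℕ → Set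
Colourable′ {n} G S k = Σ (Fin n → ℕ) λ c →
  (∀ v → v ∈ S → c v < k) × (∀ u v → u ∈ S → v ∈ S → Adj G u v → c u ≢ c v)

IsChromaticNumber′ : Graph n → Subset n → ℕ → Set
IsChromaticNumber′ G S k = Colourable′ G S k × (∀ j → Colourable′ G S j → k ≤ j)

Colourable⇒Colourable′ : Colourable G S k → Colourable′ G S k
Colourable⇒Colourable′ (c , proper) =
  toℕ ∘ c , (λ v _ → toℕ<n (c v)) , λ u v u∈S v∈S uv → proper u v u∈S v∈S uv ∘ toℕ-injective

Colourable′⇒Colourable : v ∈ S → Colourable′ G S k → Colourable G S k
Colourable′⇒Colourable {v = v} {k = zero} v∈S (_ , bounded , _) = contradiction (bounded v v∈S) λ ()
Colourable′⇒Colourable {n} {S = S} {k = suc j} _ (c , bounded , proper) =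
  clamp , λ u v u∈S v∈S uv eq →
    proper u v u∈S v∈S uv (trans (≡.sym (toℕ-clamp u∈S)) (trans (cong toℕ eq) (toℕ-clamp v∈S)))
  where
  clamp : Fin n → Fin (suc j)
  clamp v = fromℕ< (s≤s (m⊓n≤n (c v) j))
  toℕ-clamp : v ∈ S → toℕ (clamp v) ≡ c v
  toℕ-clamp {v} v∈S = trans (toℕ-fromℕ< _) (m≤n⇒m⊓n≡m (≤-pred (bounded v v∈S)))

IsChromaticNumber⇒IsChromaticNumber′ : v ∈ S → IsChromaticNumber G S k → IsChromaticNumber′ G S k
IsChromaticNumber⇒IsChromaticNumber′ {G = G} v∈S (col , least) =
  Colourable⇒Colourable′ {G = G} col , λ j col′ → least j (Colourable′⇒Colourable {G = G} v∈S col′)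

IsChromaticNumber-unique : IsChromaticNumber G S k → IsChromaticNumber G S j → k ≡ j
IsChromaticNumber-unique (colₖ , leastₖ) (colⱼ , leastⱼ) = ≤-antisym (leastₖ _ colⱼ) (leastⱼ _ colₖ)

Colourable′-order : (G : Graph n) (S : Subset n) → Colourable′ G S n
Colourable′-order G S = toℕ , (λ v _ → toℕ<n v) , λ u v _ _ uv eq →
  Adj-irrefl G v (subst (λ u → Adj G u v) (toℕ-injective eq) uv)

IsChromaticNumber′≤order : {G : Graph n} {S : Subset n} → IsChromaticNumber′ G S k → k ≤ n
IsChromaticNumber′≤order {G = G} {S = S} (_ , least) = least _ (Colourable′-order G S)

IsClique-⊆ : T ⊆ S → IsClique G T K → IsClique G S K
IsClique-⊆ T⊆S (K⊆T , adjacent) = T⊆S ∘ K⊆T , adjacent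

IsCliqueNumber-unique : IsCliqueNumber G S w → IsCliqueNumber G S k → w ≡ k
IsCliqueNumber-unique ((K , clique , refl) , max) ((K′ , clique′ , refl) , max′) =
  ≤-antisym (max′ K clique) (max K′ clique′)

IsCliqueNumber-mono : T ⊆ S → IsCliqueNumber G S w → IsCliqueNumber G T j → j ≤ w
IsCliqueNumber-mono {G = G} T⊆S (_ , maxS) ((K , clique , refl) , _) = maxS K (IsClique-⊆ {G = G} T⊆S clique)

IsCliqueNumber-positive : v ∈ S → IsCliqueNumber G S w → 1 ≤ w
IsCliqueNumber-positive {v = v} {S = S} v∈S (_ , max) =
  subst (_≤ _) (∣⁅x⁆∣≡1 v) (max ⁅ v ⁆ (singleton⊆ , λ u u′ u∈ u′∈ u≢u′ →
    contradiction (trans (x∈⁅y⁆⇒x≡y v u∈) (≡.sym (x∈⁅y⁆⇒x≡y v u′∈))) u≢u′))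
  where
  singleton⊆ : ⁅ v ⁆ ⊆ S
  singleton⊆ u∈ = subst (_∈ S) (≡.sym (x∈⁅y⁆⇒x≡y v u∈)) v∈S

-- Deleting an independent set

record IndependentDeletion (G : Graph n) (S T : Subset n) : Set where
  field
    T⊆S         : T ⊆ S
    deleted     : Fin n
    deleted∈S   : deleted ∈ S
    deleted∉T   : deleted ∉ T
    independent : ∀ u v → u ∈ S → u ∉ T → v ∈ S → v ∉ T → ¬ Adj G u v

module _ {G : Graph n} {S T : Subset n} (D : IndependentDeletion G S T) where
  open IndependentDeletion D

  ∣T∣<∣S∣ : ∣ T ∣ < ∣ S ∣
  ∣T∣<∣S∣ = p⊂q⇒∣p∣<∣q∣ (T⊆S , deleted , deleted∈S , deleted∉T)

  Colourable′-extend : Colourable′ G T k → Colourable′ G S (suc k)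
  Colourable′-extend {k} (c , bounded , proper) = (λ v → c⁺ v (v ∈? T)) , bounded⁺ , proper⁺
    where
    c⁺ : ∀ v → Dec (v ∈ T) → ℕ
    c⁺ v (yes _) = suc (c v)
    c⁺ v (no _)  = 0
    bounded⁺ : ∀ v → v ∈ S → c⁺ v (v ∈? T) < suc k
    bounded⁺ v _ with v ∈? T
    ... | yes v∈T = s≤s (bounded v v∈T)
    ... | no _    = s≤s z≤n
    proper⁺ : ∀ u v → u ∈ S → v ∈ S → Adj G u v → c⁺ u (u ∈? T) ≢ c⁺ v (v ∈? T)
    proper⁺ u v u∈S v∈S uv with u ∈? T | v ∈? T
    ... | yes u∈T | yes v∈T = proper u v u∈T v∈T uv ∘ suc-injective
    ... | yes _   | no _    = λ ()
    ... | no _    | yes _   = λ ()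
    ... | no u∉T  | no v∉T  = ⊥-elim (independent u v u∈S u∉T v∈S v∉T uv)

  IsChromaticNumber′-deletion : IsChromaticNumber′ G S k → IsChromaticNumber′ G T j → k ≤ suc j
  IsChromaticNumber′-deletion (_ , leastS) (colT , _) = leastS _ (Colourable′-extend colT)

complement-deletion : v ∈ S → IsIndependent G S → IndependentDeletion G ⊤ (∁ S)
complement-deletion {v = v} v∈S indep = record
  { T⊆S         = λ _ → ∈⊤
  ; deleted     = v
  ; deleted∈S   = ∈⊤
  ; deleted∉T   = x∈p⇒x∉∁p v∈S
  ; independent = λ u w _ u∉ _ w∉ → indep u w (x∉∁p⇒x∈p u∉) (x∉∁p⇒x∈p w∉)
  }

module TopColourClass {G : Graph n} {S : Subset n} {k : ℕ} (c : Fin n → ℕ)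
  (bounded : ∀ v → v ∈ S → c v < suc k) (proper : ∀ u v → u ∈ S → v ∈ S → Adj G u v → c u ≢ c v) where

  top? : Decidable (λ v → c v ≡ k)
  top? v = c v ≟ k

  top remaining : Subset n
  top       = satisfying top?
  remaining = S ∩ ∁ top

  remaining⊆S : remaining ⊆ S
  remaining⊆S = proj₁ ∘ x∈p∩q⁻ S (∁ top)

  below-top : ∀ v → v ∈ remaining → c v < k
  below-top v v∈ with x∈p∩q⁻ S (∁ top) v∈
  ... | v∈S , v∈∁top = ≤∧≢⇒< (≤-pred (bounded v v∈S)) (x∈∁p⇒x∉p v∈∁top ∘ ∈satisfying⁺ top?)

  on-top : v ∈ S → v ∉ remaining → c v ≡ k
  on-top {v} v∈S v∉ with c v ≟ k
  ... | yes cv≡k = cv≡k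
  ... | no cv≢k  = ⊥-elim (v∉ (x∈p∩q⁺ (v∈S , x∉p⇒x∈∁p (cv≢k ∘ ∈satisfying⁻ top?))))

  remaining-colourable : Colourable′ G remaining k
  remaining-colourable = c , below-top , λ u v u∈ v∈ → proper u v (remaining⊆S u∈) (remaining⊆S v∈)

  empty-top-colourable : ¬ Nonempty (S ∩ top) → Colourable′ G S k
  empty-top-colourable none = c , below , proper
    where
    below : ∀ v → v ∈ S → c v < k
    below v v∈S = ≤∧≢⇒< (≤-pred (bounded v v∈S))
      λ cv≡k → none (v , x∈p∩q⁺ (v∈S , ∈satisfying⁺ top? cv≡k))

  top-deletion : Nonempty (S ∩ top) → IndependentDeletion G S remaining
  top-deletion (v₀ , v₀∈) = record
    { T⊆S         = remaining⊆S
    ; deleted     = v₀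
    ; deleted∈S   = proj₁ (x∈p∩q⁻ S top v₀∈)
    ; deleted∉T   = <-irrefl (∈satisfying⁻ top? (proj₂ (x∈p∩q⁻ S top v₀∈))) ∘ below-top v₀
    ; independent = λ u v u∈S u∉ v∈S v∉ uv →
        proper u v u∈S v∈S uv (trans (on-top u∈S u∉) (≡.sym (on-top v∈S v∉)))
    }

top-colour-class-deletion : IsChromaticNumber′ G S (suc k) →
  ∃ λ T → IndependentDeletion G S T × IsChromaticNumber′ G T k
top-colour-class-deletion {G = G} {S} {k} ((c , bounded , proper) , least) = split (nonempty? (S ∩ top))
  where
  open TopColourClass {G = G} c bounded proper
  split : Dec (Nonempty (S ∩ top)) → ∃ λ T → IndependentDeletion G S T × IsChromaticNumber′ G T k
  split (no none) = contradiction (least k (empty-top-colourable none)) (<-irrefl refl)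
  split (yes ne)  = remaining , top-deletion ne , remaining-colourable ,
    λ j col → ≤-pred (least (suc j) (Colourable′-extend (top-deletion ne) col))

∈pair⁻ : {u v z : Fin n} → z ∈ ⁅ u ⁆ ∪ ⁅ v ⁆ → z ≡ u ⊎ z ≡ v
∈pair⁻ {u = u} {v} z∈ with x∈p∪q⁻ ⁅ u ⁆ ⁅ v ⁆ z∈
... | inj₁ z∈u = inj₁ (x∈⁅y⁆⇒x≡y u z∈u)
... | inj₂ z∈v = inj₂ (x∈⁅y⁆⇒x≡y v z∈v)

non-edge-independent : ¬ Adj G u v → IsIndependent G (⁅ u ⁆ ∪ ⁅ v ⁆)
non-edge-independent {G = G} {u} {v} u≁v w w′ w∈ w′∈ with ∈pair⁻ w∈ | ∈pair⁻ w′∈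
... | inj₁ refl | inj₁ refl = Adj-irrefl G u
... | inj₂ refl | inj₂ refl = Adj-irrefl G v
... | inj₁ refl | inj₂ refl = u≁v
... | inj₂ refl | inj₁ refl = u≁v ∘ trans (Graph.sym G u v)

∣∁pair∣ : {u v : Fin n} → u ≢ v → 2 + ∣ ∁ (⁅ u ⁆ ∪ ⁅ v ⁆) ∣ ≤ n
∣∁pair∣ {n} {u} {v} u≢v =
  ≤-trans (s≤s (p⊂q⇒∣p∣<∣q∣ ∁pair⊂∁u))
    (subst (suc ∣ ∁ ⁅ u ⁆ ∣ ≤_) (∣⊤∣≡n n) (p⊂q⇒∣p∣<∣q∣ ∁u⊂⊤))
  where
  ∁pair⊂∁u : ∁ (⁅ u ⁆ ∪ ⁅ v ⁆) ⊂ ∁ ⁅ u ⁆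
  ∁pair⊂∁u = p⊆q⇒∁p⊇∁q (p⊆p∪q ⁅ v ⁆) , v ,
    x∉p⇒x∈∁p (x≢y⇒x∉⁅y⁆ (u≢v ∘ ≡.sym)) , x∈p⇒x∉∁p (q⊆p∪q ⁅ u ⁆ ⁅ v ⁆ (x∈⁅x⁆ v))
  ∁u⊂⊤ : ∁ ⁅ u ⁆ ⊂ ⊤
  ∁u⊂⊤ = (λ _ → ∈⊤) , u , ∈⊤ , x∈p⇒x∉∁p (x∈⁅x⁆ u)

-- Induced subgraphs

embed : (S : Subset n) → Fin ∣ S ∣ → Fin n
embed (true ∷ S)  zero    = zero
embed (true ∷ S)  (suc i) = suc (embed S i)
embed (false ∷ S) i       = suc (embed S i)

embed-∈ : (S : Subset n) (i : Fin ∣ S ∣) → embed S i ∈ S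
embed-∈ (true ∷ S)  zero    = here
embed-∈ (true ∷ S)  (suc i) = there (embed-∈ S i)
embed-∈ (false ∷ S) i       = there (embed-∈ S i)

embed-injective : (S : Subset n) {i j : Fin ∣ S ∣} → embed S i ≡ embed S j → i ≡ j
embed-injective (true ∷ S)  {zero}  {zero}  _  = refl
embed-injective (true ∷ S)  {suc i} {suc j} eq = cong suc (embed-injective S (suc-injectiveᶠ eq))
embed-injective (false ∷ S)                 eq = embed-injective S (suc-injectiveᶠ eq)

index : (S : Subset n) → v ∈ S → Fin ∣ S ∣
index (true ∷ S)  here           = zero
index (true ∷ S)  (there v∈S)    = suc (index S v∈S)
index (false ∷ S) (there v∈S)    = index S v∈S

embed-index : (S : Subset n) (v∈S : v ∈ S) → embed S (index S v∈S) ≡ v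
embed-index (true ∷ S)  here        = refl
embed-index (true ∷ S)  (there v∈S) = cong suc (embed-index S v∈S)
embed-index (false ∷ S) (there v∈S) = cong suc (embed-index S v∈S)

preimage : (S K : Subset n) → Subset ∣ S ∣
preimage []          []      = []
preimage (true ∷ S)  (b ∷ K) = b ∷ preimage S K
preimage (false ∷ S) (_ ∷ K) = preimage S K

image : (S : Subset n) → Subset ∣ S ∣ → Subset n
image []          _        = []
image (true ∷ S)  (b ∷ K′) = b ∷ image S K′
image (false ∷ S) K′       = false ∷ image S K′

∈preimage⁻ : (S K : Subset n) {i : Fin ∣ S ∣} → i ∈ preimage S K → embed S i ∈ K
∈preimage⁻ (true ∷ S)  (true ∷ K) here     = here
∈preimage⁻ (true ∷ S)  (_ ∷ K) (there i∈)  = there (∈preimage⁻ S K i∈)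
∈preimage⁻ (false ∷ S) (_ ∷ K) i∈          = there (∈preimage⁻ S K i∈)

∈image⁻ : (S : Subset n) (K′ : Subset ∣ S ∣) → v ∈ image S K′ → ∃ λ i → i ∈ K′ × embed S i ≡ v
∈image⁻ (true ∷ S)  (true ∷ K′) here = zero , here , refl
∈image⁻ (true ∷ S)  (_ ∷ K′) (there v∈) with ∈image⁻ S K′ v∈
... | i , i∈ , refl = suc i , there i∈ , refl
∈image⁻ (false ∷ S) K′ (there v∈) with ∈image⁻ S K′ v∈
... | i , i∈ , refl = i , i∈ , refl

image⊆ : (S : Subset n) (K′ : Subset ∣ S ∣) → image S K′ ⊆ S
image⊆ S K′ v∈ with ∈image⁻ S K′ v∈
... | i , _ , refl = embed-∈ S i

∣∷∣-cong : ∀ {m} (b : Bool) (p : Subset n) (q : Subset m) → ∣ p ∣ ≡ ∣ q ∣ → ∣ b ∷ p ∣ ≡ ∣ b ∷ q ∣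
∣∷∣-cong true  _ _ = cong suc
∣∷∣-cong false _ _ = id

∣preimage∣ : (S K : Subset n) → K ⊆ S → ∣ preimage S K ∣ ≡ ∣ K ∣
∣preimage∣ []          []          _   = refl
∣preimage∣ (true ∷ S)  (b ∷ K)     K⊆S =
  ∣∷∣-cong b (preimage S K) K (∣preimage∣ S K (drop-there ∘ K⊆S ∘ there))
∣preimage∣ (false ∷ S) (true ∷ K)  K⊆S with K⊆S here
... | ()
∣preimage∣ (false ∷ S) (false ∷ K) K⊆S = ∣preimage∣ S K (drop-there ∘ K⊆S ∘ there)

∣image∣ : (S : Subset n) (K′ : Subset ∣ S ∣) → ∣ image S K′ ∣ ≡ ∣ K′ ∣
∣image∣ []          []       = refl
∣image∣ (true ∷ S)  (b ∷ K′) = ∣∷∣-cong b (image S K′) K′ (∣image∣ S K′)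
∣image∣ (false ∷ S) K′       = ∣image∣ S K′

induced : Graph n → (S : Subset n) → Graph ∣ S ∣
induced G S = record
  { adj    = λ i j → adj G (embed S i) (embed S j)
  ; sym    = λ i j → Graph.sym G (embed S i) (embed S j)
  ; irrefl = λ i → irrefl G (embed S i)
  }

module _ (G : Graph n) (S : Subset n) where

  Colourable′⇒Colourable-induced : Colourable′ G S k → Colourable (induced G S) ⊤ k
  Colourable′⇒Colourable-induced (c , bounded , proper) = c′ , λ i j _ _ ij eq →
    proper (embed S i) (embed S j) (embed-∈ S i) (embed-∈ S j) ij
      (trans (≡.sym (toℕ-fromℕ< _)) (trans (cong toℕ eq) (toℕ-fromℕ< _)))
    where
    c′ : Fin ∣ S ∣ → Fin _
    c′ i = fromℕ< (bounded (embed S i) (embed-∈ S i))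

  Colourable-induced⇒Colourable′ : Colourable (induced G S) ⊤ k → Colourable′ G S k
  Colourable-induced⇒Colourable′ {k} (c , proper) = (λ v → c′ v (v ∈? S)) , bounded , proper′
    where
    c′ : ∀ v → Dec (v ∈ S) → ℕ
    c′ v (yes v∈S) = toℕ (c (index S v∈S))
    c′ v (no _)    = 0
    bounded : ∀ v → v ∈ S → c′ v (v ∈? S) < k
    bounded v v∈S with v ∈? S
    ... | yes _   = toℕ<n _
    ... | no v∉S  = contradiction v∈S v∉S
    proper′ : ∀ u v → u ∈ S → v ∈ S → Adj G u v → c′ u (u ∈? S) ≢ c′ v (v ∈? S)
    proper′ u v u∈S v∈S uv with u ∈? S | v ∈? S
    ... | yes u∈ | yes v∈ = proper (index S u∈) (index S v∈) ∈⊤ ∈⊤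
            (subst₂ (Adj G) (≡.sym (embed-index S u∈)) (≡.sym (embed-index S v∈)) uv)
          ∘ toℕ-injective
    ... | no u∉  | _      = contradiction u∈S u∉
    ... | _      | no v∉  = contradiction v∈S v∉

  induced-χ : IsChromaticNumber′ G S k → IsChromaticNumber (induced G S) ⊤ k
  induced-χ (col , least) =
    Colourable′⇒Colourable-induced col , λ j col′ → least j (Colourable-induced⇒Colourable′ col′)

  induced-ω : IsCliqueNumber G S w → IsCliqueNumber (induced G S) ⊤ w
  induced-ω {w} ((K , (K⊆S , adjacent) , refl) , max) =
    (preimage S K , clique-preimage , ∣preimage∣ S K K⊆S) ,
    λ K′ clique′ → subst (_≤ w) (∣image∣ S K′) (max (image S K′) (image⊆ S K′ , adjacent-image K′ clique′))
    where
    clique-preimage : IsClique (induced G S) ⊤ (preimage S K)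
    clique-preimage = (λ _ → ∈⊤) , λ i j i∈ j∈ i≢j →
      adjacent (embed S i) (embed S j) (∈preimage⁻ S K i∈) (∈preimage⁻ S K j∈) (i≢j ∘ embed-injective S)
    adjacent-image : ∀ K′ → IsClique (induced G S) ⊤ K′ →
      ∀ u v → u ∈ image S K′ → v ∈ image S K′ → u ≢ v → Adj G u v
    adjacent-image K′ (_ , adjacent′) u v u∈ v∈ u≢v with ∈image⁻ S K′ u∈ | ∈image⁻ S K′ v∈
    ... | i , i∈ , refl | j , j∈ , refl = adjacent′ i j i∈ j∈ (u≢v ∘ cong (embed S))

-- χ and ω are only shown to exist under ¬¬; every goal that needs them is a negation or decidable.
module _ {P : ℕ → Set} where
  open RawMonad (¬¬-Monad {a = 0ℓ})

  ¬¬-least : ∀ m → P m → ¬ ¬ (∃ λ k → P k × ∀ j → P j → k ≤ j)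
  ¬¬-least = <-rec _ λ m rec Pm → ¬¬-excluded-middle {A = ∃ λ j → j < m × P j} >>= λ where
    (yes (j , j<m , Pj)) → rec j<m Pj
    (no ∄j)              → pure (m , Pm , λ j Pj → ≮⇒≥ λ j<m → ∄j (j , j<m , Pj))

  ¬¬-greatest : ∀ B → (∀ j → P j → j ≤ B) → ∀ m → P m → ¬ ¬ (∃ λ k → P k × ∀ j → P j → j ≤ k)
  ¬¬-greatest B bounded m = search B m (m≤m+n B m)
    where
    search : ∀ d m → B ≤ d + m → P m → ¬ ¬ (∃ λ k → P k × ∀ j → P j → j ≤ k)
    search zero    m B≤m Pm = pure (m , Pm , λ j Pj → ≤-trans (bounded j Pj) B≤m)
    search (suc d) m B≤  Pm = ¬¬-excluded-middle {A = ∃ λ j → m < j × P j} >>= λ where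
      (yes (j , m<j , Pj)) →
        search d j (≤-trans B≤ (≤-trans (≤-reflexive (≡.sym (+-suc d m))) (+-monoʳ-≤ d m<j))) Pj
      (no ∄j)              → pure (m , Pm , λ j Pj → ≮⇒≥ λ m<j → ∄j (j , m<j , Pj))

¬¬-chromatic-number : (G : Graph n) (S : Subset n) → ¬ ¬ ∃ (IsChromaticNumber′ G S)
¬¬-chromatic-number {n} G S = ¬¬-least n (Colourable′-order G S)

¬¬-clique-number : (G : Graph n) (S : Subset n) → ¬ ¬ ∃ (IsCliqueNumber G S)
¬¬-clique-number {n} G S ∄ω = ¬¬-greatest n bounded 0 (∅ , ∅-clique , ∣⊥∣≡0 n)
  λ (w , (K , clique , ∣K∣≡w) , max) →
    ∄ω (w , (K , clique , ∣K∣≡w) , λ K′ clique′ → max _ (K′ , clique′ , refl))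
  where
  bounded : ∀ j → (∃ λ K → IsClique G S K × ∣ K ∣ ≡ j) → j ≤ n
  bounded j (K , _ , refl) = ∣p∣≤n K
  ∅-clique : IsClique G S ∅
  ∅-clique = (λ v∈∅ → contradiction v∈∅ ∉⊥) , λ u _ u∈∅ → contradiction u∈∅ ∉⊥

-- Arithmetic of the size condition

gap-positive : ∀ {n x χ ω} → n + x + 2 * ω < 3 * χ → χ ≤ n → ω < χ
gap-positive {n} {x} {χ} {ω} bound χ≤n = *-cancelˡ-< 2 ω χ (+-cancelˡ-< χ (2 * ω) (2 * χ) (begin-strict
  χ + 2 * ω       ≤⟨ +-monoˡ-≤ (2 * ω) (≤-trans χ≤n (m≤m+n n x)) ⟩
  n + x + 2 * ω   <⟨ bound ⟩
  3 * χ           ∎))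
  where open ≤-Reasoning

bound-transfer : ∀ {s n x χ ω k w} → s + χ ≤ n + k → k + ω ≡ χ + w →
  n + x + 2 * ω < 3 * χ → s + x + 2 * w < 3 * k
bound-transfer {s} {n} {x} {χ} {ω} {k} {w} deficient balanced bound =
  +-cancelˡ-< (3 * χ) (s + x + 2 * w) (3 * k) (begin-strict
    3 * χ + (s + x + 2 * w)        ≡⟨ regroup s x χ w ⟩
    (s + χ) + x + 2 * (χ + w)      ≡⟨ cong (λ m → (s + χ) + x + 2 * m) (≡.sym balanced) ⟩
    (s + χ) + x + 2 * (k + ω)      ≤⟨ +-monoˡ-≤ (2 * (k + ω)) (+-monoˡ-≤ x deficient) ⟩
    (n + k) + x + 2 * (k + ω)      ≡⟨ regroup′ n k x ω ⟩
    3 * k + (n + x + 2 * ω)        <⟨ +-monoʳ-< (3 * k) bound ⟩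
    3 * k + 3 * χ                  ≡⟨ +-comm (3 * k) (3 * χ) ⟩
    3 * χ + 3 * k                  ∎)
  where
  open ≤-Reasoning
  regroup : ∀ s x χ w → 3 * χ + (s + x + 2 * w) ≡ (s + χ) + x + 2 * (χ + w)
  regroup = ℕRing.solve-∀
  regroup′ : ∀ n k x ω → (n + k) + x + 2 * (k + ω) ≡ 3 * k + (n + x + 2 * ω)
  regroup′ = ℕRing.solve-∀

bound-after-pair-deletion : ∀ {t n x ω k} → 2 + t ≤ n → suc (n + x + 2 * ω) < 3 * suc k →
  t + x + 2 * ω < 3 * k
bound-after-pair-deletion {t} {n} {x} {ω} {k} 2+t≤n bound =
  +-cancelˡ-< 3 (t + x + 2 * ω) (3 * k) (begin-strict
    3 + (t + x + 2 * ω)       ≡⟨ regroup t x ω ⟩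
    suc (2 + t + x + 2 * ω)   ≤⟨ s≤s (+-monoˡ-≤ (2 * ω) (+-monoˡ-≤ x 2+t≤n)) ⟩
    suc (n + x + 2 * ω)       <⟨ bound ⟩
    3 * suc k                 ≡⟨ *-suc 3 k ⟩
    3 + 3 * k                 ∎)
  where
  open ≤-Reasoning
  regroup : ∀ t x ω → 3 + (t + x + 2 * ω) ≡ suc (2 + t + x + 2 * ω)
  regroup = ℕRing.solve-∀

deficiency-step : ∀ {t s n χ k} → t < s → s + χ ≤ n + suc k → t + χ ≤ n + k
deficiency-step {t} {s} {n} {χ} {k} t<s deficient = ≤-pred (begin
  suc t + χ   ≤⟨ +-monoˡ-≤ χ t<s ⟩
  s + χ       ≤⟨ deficient ⟩
  n + suc k   ≡⟨ +-suc n k ⟩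
  suc (n + k) ∎)
  where open ≤-Reasoning

forced-drop : ∀ {a b c d} → b ≤ suc a → c ≤ d → a + d < b + c → b ≡ suc a × c ≡ d
forced-drop {a} {b} {c} {d} b≤1+a c≤d lt = b≡1+a , ≤-antisym c≤d d≤c
  where
  b≡1+a : b ≡ suc a
  b≡1+a = ≤-antisym b≤1+a (+-cancelʳ-< d a b (<-≤-trans lt (+-monoʳ-≤ b c≤d)))
  d≤c : d ≤ c
  d≤c = +-cancelˡ-≤ a d c (≤-pred (subst (λ m → a + d < m + c) b≡1+a lt))

open import Data.Integer using (+_)

fval-cong : ∀ {a b c d} → a + d ≡ c + b → fval a b ≡ fval c d
fval-cong {a} {b} {c} {d} eq = begin
  + a ℤ.- + b                      ≡⟨ add-both (+ a) (+ b) (+ d) ⟩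
  (+ a ℤ.+ + d) ℤ.- (+ b ℤ.+ + d)   ≡⟨ ≡.sym (cong (ℤ._- (+ b ℤ.+ + d)) (ℤP.pos-+ a d)) ⟩
  + (a + d) ℤ.- (+ b ℤ.+ + d)       ≡⟨ cong (λ m → + m ℤ.- (+ b ℤ.+ + d)) eq ⟩
  + (c + b) ℤ.- (+ b ℤ.+ + d)       ≡⟨ cong (ℤ._- (+ b ℤ.+ + d)) (ℤP.pos-+ c b) ⟩
  (+ c ℤ.+ + b) ℤ.- (+ b ℤ.+ + d)   ≡⟨ cancel-middle (+ c) (+ b) (+ d) ⟩
  + c ℤ.- + d                      ∎
  where
  open ≡-Reasoning
  add-both : ∀ i j k → i ℤ.- j ≡ (i ℤ.+ k) ℤ.- (j ℤ.+ k)
  add-both = ℤRing.solve-∀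
  cancel-middle : ∀ i j k → (i ℤ.+ j) ℤ.- (j ℤ.+ k) ≡ i ℤ.- k
  cancel-middle = ℤRing.solve-∀

fval-monoˡ : ∀ {a b c} → a ≤ b → fval a c ℤ.≤ fval b c
fval-monoˡ {c = c} a≤b = ℤP.+-monoˡ-≤ (ℤ.- + c) (ℤ.+≤+ a≤b)

-- The size condition |V| < χ + 2f − x of M(x,y), with the negative terms x and 2ω moved to the left.
module SizeCondition (n χ ω x : ℕ) where
  open ≡-Reasoning

  slack limit : ℤ
  slack = + x ℤ.+ + 2 ℤ.* + ω
  limit = + χ ℤ.+ + 2 ℤ.* fval χ ω ℤ.- + x

  +-cancelʳ : ∀ i j → i ℤ.+ j ℤ.- j ≡ i
  +-cancelʳ = ℤRing.solve-∀

  lhs-shift : + (n + x + 2 * ω) ≡ + n ℤ.+ slack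
  lhs-shift = begin
    + (n + x + 2 * ω)               ≡⟨ ℤP.pos-+ (n + x) (2 * ω) ⟩
    + (n + x) ℤ.+ + (2 * ω)          ≡⟨ cong₂ ℤ._+_ (ℤP.pos-+ n x) (ℤP.pos-* 2 ω) ⟩
    + n ℤ.+ + x ℤ.+ + 2 ℤ.* + ω      ≡⟨ ℤP.+-assoc (+ n) (+ x) (+ 2 ℤ.* + ω) ⟩
    + n ℤ.+ slack                   ∎

  rhs-shift : + (3 * χ) ≡ limit ℤ.+ slack
  rhs-shift = trans (ℤP.pos-* 3 χ) (identity (+ χ) (+ ω) (+ x))
    where
    identity : ∀ c w y → + 3 ℤ.* c ≡ (c ℤ.+ + 2 ℤ.* (c ℤ.- w) ℤ.- y) ℤ.+ (y ℤ.+ + 2 ℤ.* w)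
    identity = ℤRing.solve-∀

  size-condition⇔ : (+ n ℤ.< limit) ⇔ (n + x + 2 * ω < 3 * χ)
  size-condition⇔ = mk⇔
    (λ n<limit → ℤP.drop‿+<+ (subst₂ ℤ._<_ (≡.sym lhs-shift) (≡.sym rhs-shift) (ℤP.+-monoˡ-< slack n<limit)))
    (λ lt → subst₂ ℤ._<_ (+-cancelʳ (+ n) slack) (+-cancelʳ limit slack)
       (ℤP.+-monoˡ-< (ℤ.- slack) (subst₂ ℤ._<_ lhs-shift rhs-shift (ℤ.+<+ lt))))

  size-condition-tight : suc (n + x + 2 * ω) ≡ 3 * χ → + n ≡ limit ℤ.- + 1
  size-condition-tight eq = begin
    + n                                        ≡⟨ unshift (+ n) slack ⟩
    (+ 1 ℤ.+ (+ n ℤ.+ slack)) ℤ.- slack ℤ.- + 1  ≡⟨ cong (λ i → (+ 1 ℤ.+ i) ℤ.- slack ℤ.- + 1) lhs-shift ⟨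
    + suc (n + x + 2 * ω) ℤ.- slack ℤ.- + 1     ≡⟨ cong (λ m → + m ℤ.- slack ℤ.- + 1) eq ⟩
    + (3 * χ) ℤ.- slack ℤ.- + 1                 ≡⟨ cong (λ i → i ℤ.- slack ℤ.- + 1) rhs-shift ⟩
    (limit ℤ.+ slack) ℤ.- slack ℤ.- + 1         ≡⟨ cong (ℤ._- + 1) (+-cancelʳ limit slack) ⟩
    limit ℤ.- + 1                              ∎
    where
    unshift : ∀ i j → i ≡ (+ 1 ℤ.+ (i ℤ.+ j)) ℤ.- j ℤ.- + 1
    unshift = ℤRing.solve-∀

-- In ℕ, f(H) < f(G₀) reads χ(H) + ω < χ + ω(H), and d(H) ≤ d(G₀) reads |V(H)| + χ ≤ n + χ(H).
module Minimal (x : ℕ) (y : ℤ) {n} (G : Graph n)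
  (minimal : ∀ m (H : Graph m) → InM (+ x) y H → n ≤ m)
  {χ ω : ℕ} (isχ : IsChromaticNumber′ G ⊤ χ) (isω : IsCliqueNumber G ⊤ ω)
  (bound : n + x + 2 * ω < 3 * χ) (gap≤y : fval χ ω ℤ.≤ y) where

  no-smaller-graph-in-M : ∣ S ∣ < n → IsChromaticNumber′ G S k → IsCliqueNumber G S w →
    fval k w ℤ.≤ y → ∣ S ∣ + x + 2 * w < 3 * k → ⊥
  no-smaller-graph-in-M {S} {k} {w} ∣S∣<n isχS isωS gap size = <⇒≱ ∣S∣<n (minimal ∣ S ∣ (induced G S)
    (k , w , induced-χ G S isχS , induced-ω G S isωS , Equivalence.from (size-condition⇔ ∣ S ∣ k w x) size , gap))
    where open SizeCondition using (size-condition⇔)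

  χ≤n : χ ≤ n
  χ≤n = IsChromaticNumber′≤order {G = G} isχ

  ω<χ : ω < χ
  ω<χ = gap-positive {n} {x} bound χ≤n

  deficient-subgraph-has-smaller-gap : ∀ k {S w} → ∣ S ∣ < n → ∣ S ∣ + χ ≤ n + k →
    IsChromaticNumber′ G S k → IsCliqueNumber G S w → k + ω < χ + w
  deficient-subgraph-has-smaller-gap zero {w = w} _ _ _ _ = ≤-trans ω<χ (m≤m+n χ w)
  deficient-subgraph-has-smaller-gap (suc k) {S} {w} ∣S∣<n deficient isχS isωS
    with top-colour-class-deletion {G = G} isχS
  ... | T , D , isχT = decidable-stable (suc k + ω <? χ + w) λ ¬goal →
    ¬¬-clique-number G T λ (wT , isωT) → ¬goal (strict (≤-trans
      (deficient-subgraph-has-smaller-gap k (<-trans (∣T∣<∣S∣ D) ∣S∣<n)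
        (deficiency-step {n = n} {χ} (∣T∣<∣S∣ D) deficient) isχT isωT)
      (+-monoʳ-≤ χ (IsCliqueNumber-mono {G = G} (IndependentDeletion.T⊆S D) isωS isωT))))
    where
    strict : suc k + ω ≤ χ + w → suc k + ω < χ + w
    strict le with m≤n⇒m<n∨m≡n le
    ... | inj₁ lt = lt
    ... | inj₂ balanced = ⊥-elim (no-smaller-graph-in-M ∣S∣<n isχS isωS
      (subst (ℤ._≤ y) (≡.sym (fval-cong {suc k} {w} {χ} {ω} balanced)) gap≤y)
      (bound-transfer {∣ S ∣} {n} {x} {χ} {ω} {suc k} {w} deficient balanced bound))

  deletion-lowers-χ-keeps-ω : IndependentDeletion G ⊤ T → IsChromaticNumber′ G T k → IsCliqueNumber G T w →
    χ ≡ suc k × w ≡ ω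
  deletion-lowers-χ-keeps-ω {T} {k} D isχT isωT =
    forced-drop χ≤1+k (IsCliqueNumber-mono {G = G} (IndependentDeletion.T⊆S D) isω isωT)
      (deficient-subgraph-has-smaller-gap _ ∣T∣<n
        (deficiency-step {n = n} {χ} ∣T∣<n (+-monoʳ-≤ n χ≤1+k)) isχT isωT)
    where
    ∣T∣<n : ∣ T ∣ < n
    ∣T∣<n = subst (∣ T ∣ <_) (∣⊤∣≡n n) (∣T∣<∣S∣ D)
    χ≤1+k : χ ≤ suc k
    χ≤1+k = IsChromaticNumber′-deletion D isχ isχT

  not-edgeless : Fin n → ¬ (∀ u v → ¬ Adj G u v)
  not-edgeless v edgeless = <-irrefl refl (begin-strict
    1 ≤⟨ IsCliqueNumber-positive {v = v} {G = G} ∈⊤ isω ⟩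
    ω <⟨ ω<χ ⟩
    χ ≤⟨ proj₂ isχ 1 ((λ _ → 0) , (λ _ _ → s≤s z≤n) , λ u v _ _ uv _ → edgeless u v uv) ⟩
    1 ∎)
    where open ≤-Reasoning

  not-complete : ¬ (∀ u v → u ≢ v → Adj G u v)
  not-complete complete = <-irrefl refl (<-≤-trans ω<χ (≤-trans χ≤n n≤ω))
    where
    n≤ω : n ≤ ω
    n≤ω = subst (_≤ ω) (∣⊤∣≡n n) (proj₂ isω ⊤ (id , λ u v _ _ → complete u v))

  complement-nonempty : {A : Subset n} → Fin n → IsIndependent G A → Nonempty (∁ A)
  complement-nonempty {A} v indep with nonempty? (∁ A)
  ... | yes ne = ne
  ... | no empty = ⊥-elim (not-edgeless v λ u w → indep u w (in-A u) (in-A w))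
    where
    in-A : ∀ u → u ∈ A
    in-A u = x∉∁p⇒x∈p λ u∈∁A → empty (u , u∈∁A)

  pair-deletion-leaves-no-room : {u v : Fin n} → u ≢ v → ¬ Adj G u v → ¬ (suc (n + x + 2 * ω) < 3 * χ)
  pair-deletion-leaves-no-room {u} {v} u≢v u≁v room =
    ¬¬-chromatic-number G remaining λ (_ , isχT) → ¬¬-clique-number G remaining λ (_ , isωT) → absurd isχT isωT
    where
    remaining : Subset n
    remaining = ∁ (⁅ u ⁆ ∪ ⁅ v ⁆)
    absurd : IsChromaticNumber′ G remaining k → IsCliqueNumber G remaining w → ⊥
    absurd {k} {w} isχT isωT with deletion-lowers-χ-keeps-ω
      (complement-deletion (p⊆p∪q ⁅ v ⁆ (x∈⁅x⁆ u)) (non-edge-independent {G = G} u≁v)) isχT isωT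
    ... | χ≡1+k , w≡ω = no-smaller-graph-in-M (≤-trans (n≤1+n _) (∣∁pair∣ u≢v)) isχT isωT
      (ℤP.≤-trans (ℤP.≤-reflexive (cong (fval k) w≡ω))
        (ℤP.≤-trans (fval-monoˡ {c = ω} (n≤1+n k)) (subst (λ c → fval c ω ℤ.≤ y) χ≡1+k gap≤y)))
      (subst (λ m → ∣ remaining ∣ + x + 2 * m < 3 * k) (≡.sym w≡ω)
        (bound-after-pair-deletion {x = x} {ω} (∣∁pair∣ u≢v)
          (subst (λ c → suc (n + x + 2 * ω) < 3 * c) χ≡1+k room)))

  no-room-to-spare : suc (n + x + 2 * ω) ≡ 3 * χ
  no-room-to-spare = ≤-antisym bound (≮⇒≥ λ room →
    ¬¬-excluded-middle {A = ∃₂ λ u v → u ≢ v × ¬ Adj G u v} λ where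
      (yes (u , v , u≢v , u≁v)) → pair-deletion-leaves-no-room u≢v u≁v room
      (no none) → not-complete λ u v u≢v →
        decidable-stable (adj G u v ≟ᵇ true) λ u≁v → none (u , v , u≢v , u≁v))

lemma3p1 : (x y : ℤ) → + 0 ℤ.≤ x → (n : ℕ) (G₀ : Graph n) → IsMinimalInM x y G₀ →
    (A : Subset n) → Nonempty A → IsIndependent G₀ A →
    (χ₀ ω₀ χ₀' ω₀' : ℕ) →
    IsChromaticNumber G₀ ⊤ χ₀ → IsCliqueNumber G₀ ⊤ ω₀ →
    IsChromaticNumber G₀ (∁ A) χ₀' → IsCliqueNumber G₀ (∁ A) ω₀' →
    (suc χ₀' ≡ χ₀) × (ω₀' ≡ ω₀) ×
    (+ n ≡ + χ₀ ℤ.+ + 2 ℤ.* fval χ₀ ω₀ ℤ.- x ℤ.- + 1)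
lemma3p1 .(+ x) y (ℤ.+≤+ {n = x} _) n G₀ ((χ , ω , isχ , isω , bound , gap≤y) , minimal)
  A (a , a∈A) indep χ₀ ω₀ χ₀' ω₀' isχ₀ isω₀ isχ₀' isω₀'
  with refl ← IsChromaticNumber-unique {G = G₀} isχ isχ₀ | refl ← IsCliqueNumber-unique {G = G₀} isω isω₀ =
  ≡.sym (proj₁ deletion-of-A) , proj₂ deletion-of-A , size-condition-tight n χ ω x no-room-to-spare
  where
  open SizeCondition using (size-condition⇔; size-condition-tight)
  open Minimal x y G₀ minimal (IsChromaticNumber⇒IsChromaticNumber′ {v = a} {G = G₀} ∈⊤ isχ) isω
    (Equivalence.to (size-condition⇔ n χ ω x) bound) gap≤y
  deletion-of-A : χ ≡ suc χ₀' × ω₀' ≡ ω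
  deletion-of-A = deletion-lowers-χ-keeps-ω (complement-deletion a∈A indep)
    (IsChromaticNumber⇒IsChromaticNumber′ {G = G₀} (proj₂ (complement-nonempty a indep)) isχ₀') isω₀'
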